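{- Let $p$ be a prime and let $A\subset\mathbb{Z}/p^2\mathbb{Z}$ be a set of coset representatives for the subgroup $p(\mathbb{Z}/p^2\mathbb{Z})$ in $\mathbb{Z}/p^2\mathbb{Z}$. For $a,b\in A$, let $a'$ be the unique element of $A$ with $a'\equiv a+b \pmod p$, and call $a+b-a'\in p(\mathbb{Z}/p^2\mathbb{Z})$ the carry of $(a,b)$; the carries matrix of $A$ is the matrix of these carries indexed by $(a,b)\in A\times A$. Suppose the carries matrix of $A$ contains only two distinct entries. Then there exist $c\in(\mathbb{Z}/p^2\mathbb{Z})^{\times}$ and $d\in p(\mathbb{Z}/p^2\mathbb{Z})$ such that either $cA+d=\{0,1,\dots,p-1\}$ or $cA+d=\{1,2,\dots,p\}$.
   Context: $cA+d=\{ca+d : a\in A\}$, computed in $\mathbb{Z}/p^2\mathbb{Z}$. -}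

module Defs where

open import Data.Nat using (ℕ; zero; suc; _+_; _*_; _∸_; _<_; _≤_; _%_)
open import Data.Nat.Divisibility using (_∣_)
open import Data.Product using (Σ; _×_; ∃-syntax)
open import Data.Sum using (_⊎_)
open import Relation.Binary.PropositionalEquality using (_≡_; _≢_)

-- Reduction modulo n (n = 0 gives the identity; only used for n ≠ 0).
-- Elements of ℤ/p²ℤ are represented by their canonical residues x < p*p.
reduce : ℕ → ℕ → ℕ
reduce zero    x = x
reduce (suc k) x = x % suc k

IsCosetReps : ℕ → (ℕ → Set) → Set
IsCosetReps p A =
  (∀ a → A a → a < p * p) ×
  (∀ x → x < p * p → ∃[ a ] (A a × reduce p a ≡ reduce p x)) ×
  (∀ a b → A a → A b → reduce p a ≡ reduce p b → a ≡ b)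

-- IsCarry p A a b e : e is the carry of (a,b), i.e. e = a + b - a' in ℤ/p²ℤ
-- where a' ∈ A with a' ≡ a + b (mod p).  (a' is unique when A is a set
-- of coset representatives.)
IsCarry : ℕ → (ℕ → Set) → ℕ → ℕ → ℕ → Set
IsCarry p A a b e =
  ∃[ a' ] (A a' × reduce p a' ≡ reduce p (a + b) ×
           e ≡ reduce (p * p) (a + b + (p * p ∸ a')))

CarriesTwoValued : ℕ → (ℕ → Set) → Set
CarriesTwoValued p A =
  ∃[ e₁ ] ∃[ e₂ ] (e₁ ≢ e₂ ×
    (∀ a b e → A a → A b → IsCarry p A a b e → (e ≡ e₁ ⊎ e ≡ e₂)) ×
    (∃[ a ] ∃[ b ] (A a × A b × IsCarry p A a b e₁)) ×
    (∃[ a ] ∃[ b ] (A a × A b × IsCarry p A a b e₂)))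

InAffineImage : ℕ → (ℕ → Set) → ℕ → ℕ → ℕ → Set
InAffineImage p A c d x = ∃[ a ] (A a × x ≡ reduce (p * p) (c * a + d))

module Submission where

-- Translating A by z = rep 0 gives a section f x = rep x - z of ℤ → ℤ/p with f 0 = 0 whose
-- carries f x + f y - f (x + y) are, modulo p², either 0 or one fixed E = u p with p ∤ u.
-- Along the multiples of u, f ((i+1) u) = f (i u) + f u - (0 or E), so f (i u) ≡ i f u - mᵢ E,
-- where mᵢ counts the nonzero carries so far.  As p u ≡ 0 this forces m_p = 1, and the carry of
-- ((p-1) u, (k+1) u) rules out that single jump occurring before the last step; hence
-- f (i u) ≡ i f u for i < p.  Multiplying by the inverse C of f u modulo p² therefore maps A - z
-- onto {0, …, p-1}: take c = C and d = -C z (so the first alternative always holds).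

open import Defs

open import Data.Nat.Base as ℕ using (ℕ; zero; suc; NonZero; nonTrivial⇒n>1)
import Data.Nat.Properties as ℕ
import Data.Nat.Divisibility as ℕ
open import Data.Nat.DivMod using (m%n<n)
open import Data.Nat.Primality using (Prime; euclidsLemma; prime⇒nonZero; prime⇒nonTrivial)
open import Data.Nat.Coprimality using (Coprime; coprime-Bézout; prime⇒coprime)
open import Data.Nat.GCD using (module Bézout)
open import Data.Integer.Base using (ℤ; +_; _+_; _-_; _*_; -_; 0ℤ; 1ℤ; _%ℕ_; _/ℕ_; ∣_∣)
open import Data.Integer.Properties
  using (m-n≡m⊖n; ∣⊖∣-≤; ⊖-≥; abs-*; pos-+; pos-*; neg-distribˡ-*; +-inverseʳ; +-identityˡ; +-identityʳ;
         *-zeroˡ; *-zeroʳ; *-identityˡ; *-identityʳ; *-comm)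
open import Data.Integer.DivMod using (a≡a%ℕn+[a/ℕn]*n; n%ℕd<d)
open import Data.Integer.Divisibility.Signed
open import Data.Integer.Tactic.RingSolver using (solve-∀)
open import Data.Product using (∃-syntax; _×_; _,_; proj₁; proj₂)
open import Data.Sum as Sum using (_⊎_; inj₁; inj₂)
open import Function.Base using (id; _∘_)
open import Function.Bundles using (_⇔_; mk⇔)
open import Relation.Binary.Bundles using (Setoid)
import Relation.Binary.Reasoning.Setoid
open import Relation.Binary.PropositionalEquality
open import Relation.Nullary using (¬_; contradiction)

-- Congruence modulo an integer

infix 4 _≡_mod_

-- A record rather than the bare divisibility m ∣ x - y, so that x, y and m are recovered
-- from the type by unification.

record _≡_mod_ (x y m : ℤ) : Set where
  constructor congruent
  field divides-difference : m ∣ x - y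

open _≡_mod_

mod-reflexive : ∀ {m x y} → x ≡ y → x ≡ y mod m
mod-reflexive {m} {x} refl = congruent (divides 0ℤ (x-x≡0*m x m))
  where x-x≡0*m : ∀ x m → x - x ≡ 0ℤ * m
        x-x≡0*m = solve-∀

mod-sym : ∀ {m x y} → x ≡ y mod m → y ≡ x mod m
mod-sym {m} {x} {y} (congruent m∣x-y) = congruent (subst (m ∣_) (neg-sub x y) (∣m⇒∣-m m∣x-y))
  where neg-sub : ∀ x y → - (x - y) ≡ y - x
        neg-sub = solve-∀

mod-trans : ∀ {m x y z} → x ≡ y mod m → y ≡ z mod m → x ≡ z mod m
mod-trans {m} {x} {y} {z} (congruent m∣x-y) (congruent m∣y-z) =
  congruent (subst (m ∣_) (telescope x y z) (∣m∣n⇒∣m+n m∣x-y m∣y-z))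
  where telescope : ∀ x y z → x - y + (y - z) ≡ x - z
        telescope = solve-∀

mod-setoid : ℤ → Setoid _ _
mod-setoid m = record
  { Carrier = ℤ
  ; _≈_ = λ x y → x ≡ y mod m
  ; isEquivalence = record { refl = mod-reflexive refl ; sym = mod-sym ; trans = mod-trans }
  }

module ≡-mod-Reasoning (m : ℤ) = Relation.Binary.Reasoning.Setoid (mod-setoid m)

+-cong-mod : ∀ {m x y x′ y′} → x ≡ x′ mod m → y ≡ y′ mod m → x + y ≡ x′ + y′ mod m
+-cong-mod {m} {x} {y} {x′} {y′} (congruent hx) (congruent hy) =
  congruent (subst (m ∣_) (regroup x y x′ y′) (∣m∣n⇒∣m+n hx hy))
  where regroup : ∀ x y x′ y′ → x - x′ + (y - y′) ≡ x + y - (x′ + y′)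
        regroup = solve-∀

+-congˡ-mod : ∀ {m} x {y y′} → y ≡ y′ mod m → x + y ≡ x + y′ mod m
+-congˡ-mod x = +-cong-mod (mod-reflexive {x = x} refl)

+-congʳ-mod : ∀ {m} x {y y′} → y ≡ y′ mod m → y + x ≡ y′ + x mod m
+-congʳ-mod x y≡y′ = +-cong-mod y≡y′ (mod-reflexive {x = x} refl)

-‿cong-mod : ∀ {m x y} → x ≡ y mod m → - x ≡ - y mod m
-‿cong-mod {m} {x} {y} (congruent h) = congruent (subst (m ∣_) (regroup x y) (∣m⇒∣-m h))
  where regroup : ∀ x y → - (x - y) ≡ - x - - y
        regroup = solve-∀

-cong-mod : ∀ {m x y x′ y′} → x ≡ x′ mod m → y ≡ y′ mod m → x - y ≡ x′ - y′ mod m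
-cong-mod hx hy = +-cong-mod hx (-‿cong-mod hy)

*-congˡ-mod : ∀ {m x y} k → x ≡ y mod m → k * x ≡ k * y mod m
*-congˡ-mod {m} {x} {y} k (congruent h) = congruent (subst (m ∣_) (distrib k x y) (∣n⇒∣m*n k h))
  where distrib : ∀ k x y → k * (x - y) ≡ k * x - k * y
        distrib = solve-∀

*-congʳ-mod : ∀ {m x y} k → x ≡ y mod m → x * k ≡ y * k mod m
*-congʳ-mod {m} {x} {y} k (congruent h) = congruent (subst (m ∣_) (distrib k x y) (∣m⇒∣m*n k h))
  where distrib : ∀ k x y → (x - y) * k ≡ x * k - y * k
        distrib = solve-∀

*-scale-mod : ∀ {m x y} k → x ≡ y mod m → k * x ≡ k * y mod k * m
*-scale-mod {m} {x} {y} k (congruent h) = congruent (subst (k * m ∣_) (distrib k x y) (*-monoʳ-∣ k h))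
  where distrib : ∀ k x y → k * (x - y) ≡ k * x - k * y
        distrib = solve-∀

mod-weaken : ∀ {m n x y} → m ∣ n → x ≡ y mod n → x ≡ y mod m
mod-weaken m∣n (congruent n∣x-y) = congruent (∣-trans m∣n n∣x-y)

+-multiple-mod : ∀ {m} x k → x + k * m ≡ x mod m
+-multiple-mod {m} x k = congruent (divides k (cancel x k m))
  where cancel : ∀ x k m → x + k * m - x ≡ k * m
        cancel = solve-∀

*-inverse-cancel-mod : ∀ {m c u} x → c * u ≡ 1ℤ mod m → c * x * u ≡ x mod m
*-inverse-cancel-mod {m} {c} {u} x cu≡1 =
  mod-trans (mod-reflexive (reassoc c x u)) (mod-trans (*-congˡ-mod x cu≡1) (mod-reflexive (*-identityʳ x)))
  where reassoc : ∀ c x u → c * x * u ≡ x * (c * u)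
        reassoc = solve-∀

pos-∸ : ∀ {m n} → n ℕ.≤ m → + (m ℕ.∸ n) ≡ + m - + n
pos-∸ {m} {n} n≤m = trans (sym (⊖-≥ n≤m)) (sym (m-n≡m⊖n m n))

%ℕ-mod : ∀ x n .{{_ : NonZero n}} → x ≡ + (x %ℕ n) mod + n
%ℕ-mod x n = congruent (divides (x /ℕ n) (solve-shift (a≡a%ℕn+[a/ℕn]*n x n)))
  where solve-shift : ∀ {x r t} → x ≡ r + t → x - r ≡ t
        solve-shift {x} {r} {t} refl = cancel r t
          where cancel : ∀ r t → r + t - r ≡ t
                cancel = solve-∀

mod-canonical-≤ : ∀ {m r s} → r ℕ.≤ s → s ℕ.< m → + r ≡ + s mod + m → r ≡ s
mod-canonical-≤ {m} {r} {s} r≤s s<m (congruent m∣r-s) with s ℕ.∸ r in s∸r≡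
... | zero  = ℕ.≤-antisym r≤s (ℕ.m∸n≡0⇒m≤n s∸r≡)
... | suc k = contradiction (ℕ.∣⇒≤ m∣s∸r) (ℕ.<⇒≱ s∸r<m)
  where
  m∣s∸r : m ℕ.∣ suc k
  m∣s∸r = subst (m ℕ.∣_) (trans (cong ∣_∣ (m-n≡m⊖n r s)) (trans (∣⊖∣-≤ r≤s) s∸r≡))
                 (∣⇒∣ᵤ m∣r-s)
  s∸r<m : suc k ℕ.< m
  s∸r<m = subst (ℕ._< m) s∸r≡ (ℕ.≤-<-trans (ℕ.m∸n≤m s r) s<m)

mod-canonical : ∀ {m r s} → r ℕ.< m → s ℕ.< m → + r ≡ + s mod + m → r ≡ s
mod-canonical {r = r} {s} r<m s<m r≡s with ℕ.≤-total r s
... | inj₁ r≤s = mod-canonical-≤ r≤s s<m r≡s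
... | inj₂ s≤r = sym (mod-canonical-≤ s≤r r<m (mod-sym r≡s))

%ℕ-canonical : ∀ {x r} n .{{_ : NonZero n}} → r ℕ.< n → x ≡ + r mod + n → x %ℕ n ≡ r
%ℕ-canonical {x} n r<n x≡r = mod-canonical (n%ℕd<d x n) r<n (mod-trans (mod-sym (%ℕ-mod x n)) x≡r)

%-≡⇒mod : ∀ {a b} n .{{_ : NonZero n}} → a ℕ.% n ≡ b ℕ.% n → + a ≡ + b mod + n
%-≡⇒mod {a} {b} n a%n≡b%n =
  mod-trans (%ℕ-mod (+ a) n) (mod-trans (mod-reflexive (cong +_ a%n≡b%n)) (mod-sym (%ℕ-mod (+ b) n)))

mod⇒%-≡ : ∀ {a b} n .{{_ : NonZero n}} → + a ≡ + b mod + n → a ℕ.% n ≡ b ℕ.% n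
mod⇒%-≡ {a} {b} n a≡b = %ℕ-canonical n (n%ℕd<d (+ b) n) (mod-trans a≡b (%ℕ-mod (+ b) n))

-- Primes and inverses

prime∣*⇒∣⊎∣ : ∀ {p} x y → Prime p → + p ∣ x * y → (+ p ∣ x) ⊎ (+ p ∣ y)
prime∣*⇒∣⊎∣ {p} x y p-prime p∣xy =
  Sum.map ∣ᵤ⇒∣ ∣ᵤ⇒∣
    (euclidsLemma ∣ x ∣ ∣ y ∣ p-prime (subst (p ℕ.∣_) (abs-* x y) (∣⇒∣ᵤ p∣xy)))

private
  pos-1+m*n≡o*p : ∀ {m n o p} → 1 ℕ.+ m ℕ.* n ≡ o ℕ.* p → 1ℤ + + m * + n ≡ + o * + p
  pos-1+m*n≡o*p {m} {n} {o} {p} eq = begin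
    1ℤ + + m * + n   ≡⟨ cong (λ t → 1ℤ + t) (pos-* m n) ⟨
    + (1 ℕ.+ m ℕ.* n) ≡⟨ cong +_ eq ⟩
    + (o ℕ.* p)       ≡⟨ pos-* o p ⟩
    + o * + p         ∎
    where open ≡-Reasoning

  inverse-mod-prime-ℕ : ∀ {p n} → Prime p → .{{_ : NonZero n}} → n ℕ.< p → ∃[ w ] (w * + n ≡ 1ℤ mod + p)
  inverse-mod-prime-ℕ {p} {n} p-prime n<p with coprime-Bézout (prime⇒coprime p-prime n<p)
  ... | Bézout.+- x y eq = - + y , congruent (divides (- + x) (begin
    - + y * + n - 1ℤ    ≡⟨ rearrange (+ y) (+ n) ⟩
    - (1ℤ + + y * + n)  ≡⟨ cong -_ (pos-1+m*n≡o*p {y} {n} {x} {p} eq) ⟩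
    - (+ x * + p)       ≡⟨ neg-distribˡ-* (+ x) (+ p) ⟩
    - + x * + p         ∎))
    where open ≡-Reasoning
          rearrange : ∀ y n → - y * n - 1ℤ ≡ - (1ℤ + y * n)
          rearrange = solve-∀
  ... | Bézout.-+ x y eq = + y , congruent (divides (+ x) (begin
    + y * + n - 1ℤ            ≡⟨ cong (_- 1ℤ) (pos-1+m*n≡o*p {x} {p} {y} {n} eq) ⟨
    1ℤ + + x * + p - 1ℤ       ≡⟨ cancel (+ x * + p) ⟩
    + x * + p                 ∎))
    where open ≡-Reasoning
          cancel : ∀ t → 1ℤ + t - 1ℤ ≡ t
          cancel = solve-∀

inverse-mod-prime : ∀ {p} y → Prime p → ¬ (y ≡ 0ℤ mod + p) → ∃[ w ] (w * y ≡ 1ℤ mod + p)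
inverse-mod-prime {p} y p-prime y≢0 =
  let w , w*r≡1 = inverse-mod-prime-ℕ p-prime (n%ℕd<d y p) in
  w , mod-trans (*-congˡ-mod w (%ℕ-mod y p)) w*r≡1
  where
  instance
    p≢0 : NonZero p
    p≢0 = prime⇒nonZero p-prime
    r≢0 : NonZero (y %ℕ p)
    r≢0 = ℕ.≢-nonZero (λ r≡0 → y≢0 (subst (λ r → y ≡ + r mod + p) r≡0 (%ℕ-mod y p)))

-- Newton's step for inverses: 1 - w (2 - w y) y = (1 - w y)².
inverse-mod-square : ∀ {m w y} → w * y ≡ 1ℤ mod m → w * (+ 2 - w * y) * y ≡ 1ℤ mod m * m
inverse-mod-square {m} {w} {y} (congruent m∣wy-1) =
  congruent (subst (m * m ∣_) (square w y)
    (∣m⇒∣-m (∣-trans (*-monoˡ-∣ m m∣wy-1) (*-monoʳ-∣ (w * y - 1ℤ) m∣wy-1))))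
  where square : ∀ w y → - ((w * y - 1ℤ) * (w * y - 1ℤ)) ≡ w * (+ 2 - w * y) * y - 1ℤ
        square = solve-∀

mod-invertible⇒coprime : ∀ {m n} y → + m * y ≡ 1ℤ mod + n → Coprime m n
mod-invertible⇒coprime {m} y (congruent n∣my-1) {i} (i∣m , i∣n) = ℕ.∣1⇒≡1 (∣⇒∣ᵤ i∣1)
  where
  i∣1 : + i ∣ 1ℤ
  i∣1 = subst (+ i ∣_) (cancel (+ m * y))
    (∣m∣n⇒∣m-n (∣m⇒∣m*n y (∣ᵤ⇒∣ {k = + i} {i = + m} i∣m)) (∣-trans (∣ᵤ⇒∣ i∣n) n∣my-1))
    where cancel : ∀ t → t - (t - 1ℤ) ≡ 1ℤ
          cancel = solve-∀

inverse-mod-prime-square : ∀ {p} y → Prime p → ¬ (y ≡ 0ℤ mod + p) → ∃[ c ] (c * y ≡ 1ℤ mod + p * + p)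
inverse-mod-prime-square y p-prime y≢0 =
  let w , wy≡1 = inverse-mod-prime y p-prime y≢0 in
  w * (+ 2 - w * y) , inverse-mod-square {w = w} wy≡1

-- Sections of ℤ → ℤ/p with two carry values

carry : (ℤ → ℤ) → ℤ → ℤ → ℤ
carry f x y = f x + f y - f (x + y)

-- The prime is written suc q, so that q u is the last point of the walk 0, u, 2u, … .
module CarryNormalForm
  (q : ℕ) (p-prime : Prime (suc q))
  (f : ℤ → ℤ)
  (f≡id : ∀ x → f x ≡ x mod + suc q)
  (f-resp : ∀ {x y} → x ≡ y mod + suc q → f x ≡ f y)
  (f0≡0 : f 0ℤ ≡ 0ℤ)
  (u : ℤ) (u≢0 : ¬ (u ≡ 0ℤ mod + suc q))
  (carry∈0,uP : ∀ x y → (carry f x y ≡ 0ℤ mod + suc q * + suc q)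
                       ⊎ (carry f x y ≡ u * + suc q mod + suc q * + suc q))
  where

  p : ℕ
  p = suc q

  P N E : ℤ
  P = + p
  N = P * P
  E = u * P

  instance
    p≢0 : NonZero p
    p≢0 = _

  E-cancel : ∀ {k l} → k * E ≡ l * E mod N → k ≡ l mod P
  E-cancel {k} {l} (congruent N∣kE-lE) =
    Sum.[ congruent , (λ P∣u → contradiction (congruent (subst (P ∣_) (sym (+-identityʳ u)) P∣u)) u≢0) ]′
      (prime∣*⇒∣⊎∣ (k - l) u p-prime P∣[k-l]u)
    where
    P∣[k-l]u : P ∣ (k - l) * u
    P∣[k-l]u = *-cancelˡ-∣ P (subst (N ∣_) (factor k l u P) N∣kE-lE)
      where factor : ∀ k l u P → k * (u * P) - l * (u * P) ≡ P * ((k - l) * u)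
            factor = solve-∀

  open ≡-mod-Reasoning N

  Y : ℤ
  Y = f u

  f-mul : ℕ → ℤ
  f-mul i = f (+ i * u)

  jump : ℕ → ℕ
  jump i with carry∈0,uP (+ i * u) u
  ... | inj₁ _ = 0
  ... | inj₂ _ = 1

  jump≤1 : ∀ i → jump i ℕ.≤ 1
  jump≤1 i with carry∈0,uP (+ i * u) u
  ... | inj₁ _ = ℕ.z≤n
  ... | inj₂ _ = ℕ.≤-refl

  carry≡jump : ∀ i → carry f (+ i * u) u ≡ + jump i * E mod N
  carry≡jump i with carry∈0,uP (+ i * u) u
  ... | inj₁ c≡0 = mod-trans c≡0 (mod-reflexive (sym (*-zeroˡ E)))
  ... | inj₂ c≡E = mod-trans c≡E (mod-reflexive (sym (*-identityˡ E)))

  jumps : ℕ → ℕ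
  jumps zero    = 0
  jumps (suc i) = jumps i ℕ.+ jump i

  f-mul-suc : ∀ i → f-mul (suc i) ≡ f-mul i + Y - + jump i * E mod N
  f-mul-suc i = begin
    f-mul (suc i)                       ≡⟨ cong f (suc-* i) ⟩
    f (+ i * u + u)                     ≡⟨ unfold (f (+ i * u + u)) (f-mul i) Y ⟩
    f-mul i + Y - carry f (+ i * u) u   ≈⟨ +-congˡ-mod (f-mul i + Y) (-‿cong-mod (carry≡jump i)) ⟩
    f-mul i + Y - + jump i * E          ∎
    where
    suc-* : ∀ i → + suc i * u ≡ + i * u + u
    suc-* i = trans (cong (_* u) (pos-+ 1 i)) (distrib (+ i) u)
      where distrib : ∀ i u → (1ℤ + i) * u ≡ i * u + u
            distrib = solve-∀
    unfold : ∀ a b c → a ≡ b + c - (b + c - a)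
    unfold = solve-∀

  f-mul≡ : ∀ i → f-mul i ≡ + i * Y - + jumps i * E mod N
  f-mul≡ zero = mod-reflexive (trans f0≡0 (sym (zero-form Y E)))
    where zero-form : ∀ Y E → 0ℤ * Y - 0ℤ * E ≡ 0ℤ
          zero-form = solve-∀
  f-mul≡ (suc i) = begin
    f-mul (suc i)
      ≈⟨ f-mul-suc i ⟩
    f-mul i + Y - + jump i * E
      ≈⟨ +-congʳ-mod (- (+ jump i * E)) (+-congʳ-mod Y (f-mul≡ i)) ⟩
    + i * Y - + jumps i * E + Y - + jump i * E
      ≡⟨ collect (+ i) (+ jumps i) (+ jump i) Y E ⟩
    (1ℤ + + i) * Y - (+ jumps i + + jump i) * E
      ≡⟨ cong₂ (λ s t → s * Y - t * E) (pos-+ 1 i) (pos-+ (jumps i) (jump i)) ⟨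
    + suc i * Y - + jumps (suc i) * E ∎
    where collect : ∀ i m j Y E → i * Y - m * E + Y - j * E ≡ (1ℤ + i) * Y - (m + j) * E
          collect = solve-∀

  1<p : 1 ℕ.< p
  1<p = nonTrivial⇒n>1 p {{prime⇒nonTrivial p-prime}}

  E-cancel-ℕ : ∀ {j l} → j ℕ.< p → l ℕ.< p → + j * E ≡ + l * E mod N → j ≡ l
  E-cancel-ℕ j<p l<p jE≡lE = mod-canonical j<p l<p (E-cancel jE≡lE)

  jump0≡0 : jump 0 ≡ 0
  jump0≡0 = E-cancel-ℕ {jump 0} {0} (ℕ.≤-<-trans (jump≤1 0) 1<p) ℕ.z<s (begin
    + jump 0 * E                    ≈⟨ mod-sym (carry≡jump 0) ⟩
    carry f (+ 0 * u) u             ≡⟨ cong₂ (λ s t → f s + Y - f t) (*-zeroˡ u) 0u+u≡u ⟩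
    f 0ℤ + Y - Y                    ≡⟨ cong (λ t → t + Y - Y) f0≡0 ⟩
    0ℤ + Y - Y                      ≡⟨ cancel Y E ⟩
    + 0 * E                         ∎)
    where
    0u+u≡u : + 0 * u + u ≡ u
    0u+u≡u = trans (cong (_+ u) (*-zeroˡ u)) (+-identityˡ u)
    cancel : ∀ Y E → 0ℤ + Y - Y ≡ 0ℤ * E
    cancel = solve-∀

  jumps-suc≤ : ∀ i → jumps (suc i) ℕ.≤ i
  jumps-suc≤ zero    = ℕ.≤-reflexive jump0≡0
  jumps-suc≤ (suc i) =
    subst (jumps (suc (suc i)) ℕ.≤_) (ℕ.+-comm i 1) (ℕ.+-mono-≤ (jumps-suc≤ i) (jump≤1 (suc i)))

  f-mul-p≡0 : f-mul p ≡ 0ℤ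
  f-mul-p≡0 = trans (f-resp (congruent (divides u (pu≡up (+ p) u)))) f0≡0
    where pu≡up : ∀ p u → p * u - 0ℤ ≡ u * p
          pu≡up = solve-∀

  jumps-p≡1 : jumps p ≡ 1
  jumps-p≡1 = E-cancel-ℕ {jumps p} {1} (ℕ.s≤s (jumps-suc≤ q)) 1<p (begin
    + jumps p * E                     ≡⟨ rearrange (P * Y) (+ jumps p * E) ⟩
    P * Y - (P * Y - + jumps p * E)   ≈⟨ +-congˡ-mod (P * Y) (-‿cong-mod (mod-sym (f-mul≡ p))) ⟩
    P * Y - f-mul p                   ≡⟨ cong (λ t → P * Y - t) f-mul-p≡0 ⟩
    P * Y - 0ℤ                        ≈⟨ +-congʳ-mod (- 0ℤ) (*-scale-mod P (f≡id u)) ⟩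
    P * u - 0ℤ                        ≡⟨ regroup P u ⟩
    1ℤ * E                            ∎)
    where rearrange : ∀ a b → b ≡ a - (a - b)
          rearrange = solve-∀
          regroup : ∀ P u → P * u - 0ℤ ≡ 1ℤ * (u * P)
          regroup = solve-∀

  -- The walk wraps around: q u + (k+1) u ≡ k u (mod p).
  carry-last : ∀ k → carry f (+ q * u) (+ suc k * u) ≡ E - + (jumps q ℕ.+ jump k) * E mod N
  carry-last k = begin
    f-mul q + f-mul (suc k) - f (+ q * u + + suc k * u)
      ≡⟨ cong (λ t → f-mul q + f-mul (suc k) - t) (f-resp (congruent (divides u wrap-around))) ⟩
    f-mul q + f-mul (suc k) - f-mul k
      ≈⟨ +-cong-mod (+-cong-mod (f-mul≡ q) (f-mul≡ (suc k))) (-‿cong-mod (f-mul≡ k)) ⟩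
    (Q * Y - M * E) + (+ suc k * Y - + jumps (suc k) * E) - (K * Y - M′ * E)
      ≡⟨ cong₂ (λ s t → (Q * Y - M * E) + (s * Y - t * E) - (K * Y - M′ * E))
               (pos-+ 1 k) (pos-+ (jumps k) (jump k)) ⟩
    (Q * Y - M * E) + ((1ℤ + K) * Y - (M′ + j) * E) - (K * Y - M′ * E)
      ≡⟨ collect Q K M M′ j Y E ⟩
    (1ℤ + Q) * Y - (M + j) * E
      ≡⟨ cong₂ (λ s t → s * Y - t * E) (pos-+ 1 q) (pos-+ (jumps q) (jump k)) ⟨
    P * Y - + (jumps q ℕ.+ jump k) * E
      ≈⟨ +-congʳ-mod (- (+ (jumps q ℕ.+ jump k) * E)) (*-scale-mod P (f≡id u)) ⟩
    P * u - + (jumps q ℕ.+ jump k) * E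
      ≡⟨ cong (_- + (jumps q ℕ.+ jump k) * E) (*-comm P u) ⟩
    E - + (jumps q ℕ.+ jump k) * E ∎
    where
    Q K M M′ j : ℤ
    Q = + q
    K = + k
    M = + jumps q
    M′ = + jumps k
    j = + jump k
    wrap-around : + q * u + + suc k * u - + k * u ≡ u * P
    wrap-around = trans (cong (λ t → Q * u + t * u - K * u) (pos-+ 1 k))
                 (trans (wrap Q K u) (cong (u *_) (sym (pos-+ 1 q))))
      where wrap : ∀ Q K u → Q * u + (1ℤ + K) * u - K * u ≡ u * (1ℤ + Q)
            wrap = solve-∀
    collect : ∀ Q K M M′ j Y E → (Q * Y - M * E) + ((1ℤ + K) * Y - (M′ + j) * E) - (K * Y - M′ * E)
                                ≡ (1ℤ + Q) * Y - (M + j) * E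
    collect = solve-∀

  jumps-q≤1 : jumps q ℕ.≤ 1
  jumps-q≤1 = subst (jumps q ℕ.≤_) jumps-p≡1 (ℕ.m≤m+n (jumps q) (jump q))

  jumps-from-last-carry : ∀ k → + (jumps q ℕ.+ jump k) * E ≡ E - carry f (+ q * u) (+ suc k * u) mod N
  jumps-from-last-carry k = begin
    + s * E               ≡⟨ rearrange E (+ s * E) ⟩
    E - (E - + s * E)     ≈⟨ +-congˡ-mod E (-‿cong-mod (mod-sym (carry-last k))) ⟩
    E - carry f (+ q * u) (+ suc k * u) ∎
    where s = jumps q ℕ.+ jump k
          rearrange : ∀ a b → b ≡ a - (a - b)
          rearrange = solve-∀

  jumps-q+jump<p : 2 ℕ.< p → ∀ k → jumps q ℕ.+ jump k ℕ.< p
  jumps-q+jump<p 2<p k = ℕ.≤-<-trans (ℕ.+-mono-≤ jumps-q≤1 (jump≤1 k)) 2<p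

  -- The carry of (q u, (k+1) u) is 0 or E, so jumps q + jump k ≡ 1 or 0 (mod p).
  jumps-q+jump≤1 : 2 ℕ.< p → ∀ k → jumps q ℕ.+ jump k ℕ.≤ 1
  jumps-q+jump≤1 2<p k with carry∈0,uP (+ q * u) (+ suc k * u)
  ... | inj₁ c≡0 = ℕ.≤-reflexive (E-cancel-ℕ {jumps q ℕ.+ jump k} {1} (jumps-q+jump<p 2<p k) 1<p (begin
    + (jumps q ℕ.+ jump k) * E            ≈⟨ jumps-from-last-carry k ⟩
    E - carry f (+ q * u) (+ suc k * u)   ≈⟨ +-congˡ-mod E (-‿cong-mod c≡0) ⟩
    E - 0ℤ                                ≡⟨ one E ⟩
    1ℤ * E                                ∎))
    where one : ∀ E → E - 0ℤ ≡ 1ℤ * E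
          one = solve-∀
  ... | inj₂ c≡E = ℕ.≤-trans (ℕ.≤-reflexive (E-cancel-ℕ {jumps q ℕ.+ jump k} {0} (jumps-q+jump<p 2<p k) ℕ.z<s (begin
    + (jumps q ℕ.+ jump k) * E            ≈⟨ jumps-from-last-carry k ⟩
    E - carry f (+ q * u) (+ suc k * u)   ≈⟨ +-congˡ-mod E (-‿cong-mod c≡E) ⟩
    E - E                                 ≡⟨ cancel E ⟩
    0ℤ * E                                ∎))) ℕ.z≤n
    where cancel : ∀ E → E - E ≡ 0ℤ * E
          cancel = solve-∀

  jump≡0-before-q : jumps q ≡ 1 → ∀ k → k ℕ.< q → jump k ≡ 0
  jump≡0-before-q _          zero    _      = jump0≡0
  jump≡0-before-q jumps-q≡1 (suc k) 1+k<q =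
    ℕ.n≤0⇒n≡0 (ℕ.≤-pred (subst (λ m → m ℕ.+ jump (suc k) ℕ.≤ 1) jumps-q≡1
                               (jumps-q+jump≤1 2<p (suc k))))
    where 2<p : 2 ℕ.< p
          2<p = ℕ.s≤s (ℕ.≤-trans (ℕ.s≤s (ℕ.s≤s ℕ.z≤n)) 1+k<q)

  no-jump⇒jumps≡0 : ∀ n → (∀ k → k ℕ.< n → jump k ≡ 0) → jumps n ≡ 0
  no-jump⇒jumps≡0 zero    _        = refl
  no-jump⇒jumps≡0 (suc n) no-jump =
    cong₂ ℕ._+_ (no-jump⇒jumps≡0 n (λ k k<n → no-jump k (ℕ.m<n⇒m<1+n k<n))) (no-jump n ℕ.≤-refl)

  jumps-q≡0 : jumps q ≡ 0
  jumps-q≡0 = Sum.[ id , (λ jumps-q≡1 → no-jump⇒jumps≡0 q (jump≡0-before-q jumps-q≡1)) ]′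
                (ℕ.n≤1⇒n≡0∨n≡1 jumps-q≤1)

  jumps≡0-downward : ∀ d {i} → jumps (d ℕ.+ i) ≡ 0 → jumps i ≡ 0
  jumps≡0-downward zero    h = h
  jumps≡0-downward (suc d) {i} h = jumps≡0-downward d (ℕ.m+n≡0⇒m≡0 (jumps (d ℕ.+ i)) h)

  f-mul≡i*Y : ∀ i → i ℕ.< p → f-mul i ≡ + i * Y mod N
  f-mul≡i*Y i (ℕ.s≤s i≤q) = mod-trans (f-mul≡ i)
    (mod-reflexive (trans (cong (λ m → + i * Y - + m * E) jumps-i≡0) (drop (+ i * Y) E)))
    where
    jumps-i≡0 : jumps i ≡ 0
    jumps-i≡0 = jumps≡0-downward (q ℕ.∸ i) (trans (cong jumps (ℕ.m∸n+n≡m i≤q)) jumps-q≡0)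
    drop : ∀ a E → a - 0ℤ * E ≡ a
    drop = solve-∀

  Y≢0 : ¬ (Y ≡ 0ℤ mod P)
  Y≢0 Y≡0 = u≢0 (mod-trans (mod-sym (f≡id u)) Y≡0)

  C : ℤ
  C = proj₁ (inverse-mod-prime-square Y p-prime Y≢0)

  C*Y≡1 : C * Y ≡ 1ℤ mod N
  C*Y≡1 = proj₂ (inverse-mod-prime-square Y p-prime Y≢0)

  normal-form : ∀ x → C * f x ≡ + ((C * x) %ℕ p) mod N
  normal-form x = begin
    C * f x            ≡⟨ cong (C *_) (f-resp x≡i*u) ⟩
    C * f-mul i        ≈⟨ *-congˡ-mod C (f-mul≡i*Y i (n%ℕd<d (C * x) p)) ⟩
    C * (+ i * Y)      ≡⟨ swap C (+ i) Y ⟩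
    + i * (C * Y)      ≈⟨ *-congˡ-mod (+ i) C*Y≡1 ⟩
    + i * 1ℤ           ≡⟨ *-identityʳ (+ i) ⟩
    + i                ∎
    where
    i = (C * x) %ℕ p
    C*u≡1 : C * u ≡ 1ℤ mod P
    C*u≡1 = mod-trans (*-congˡ-mod C (mod-sym (f≡id u))) (mod-weaken (∣m⇒∣m*n {P} P ∣-refl) C*Y≡1)
    x≡i*u : x ≡ + i * u mod P
    x≡i*u = mod-sym (mod-trans (*-congʳ-mod u (mod-sym (%ℕ-mod (C * x) p))) (*-inverse-cancel-mod {c = C} x C*u≡1))
    swap : ∀ C i Y → C * (i * Y) ≡ i * (C * Y)
    swap = solve-∀

-- Coset representatives of p(ℤ/p²ℤ)

module CosetRepresentatives (q : ℕ) (A : ℕ → Set) (A-reps : IsCosetReps (suc q) A) where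

  p p² : ℕ
  p  = suc q
  p² = p ℕ.* p

  P N : ℤ
  P = + p
  N = + p²

  mod-P*P⇒mod-N : ∀ {x y} → x ≡ y mod P * P → x ≡ y mod N
  mod-P*P⇒mod-N {x} {y} = subst (x ≡ y mod_) (sym (pos-* p p))

  mod-N⇒mod-P*P : ∀ {x y} → x ≡ y mod N → x ≡ y mod P * P
  mod-N⇒mod-P*P {x} {y} = subst (x ≡ y mod_) (pos-* p p)

  A<p² : ∀ {a} → A a → a ℕ.< p²
  A<p² {a} = proj₁ A-reps a

  rep-spec : ∀ x → ∃[ a ] (A a × a ℕ.% p ≡ (x %ℕ p) ℕ.% p)
  rep-spec x = proj₁ (proj₂ A-reps) (x %ℕ p) (ℕ.<-≤-trans (n%ℕd<d x p) (ℕ.m≤m*n p p))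

  rep : ℤ → ℕ
  rep x = proj₁ (rep-spec x)

  rep∈A : ∀ x → A (rep x)
  rep∈A x = proj₁ (proj₂ (rep-spec x))

  rep≡ : ∀ x → + rep x ≡ x mod P
  rep≡ x = mod-trans (%-≡⇒mod p (proj₂ (proj₂ (rep-spec x)))) (mod-sym (%ℕ-mod x p))

  rep-unique : ∀ {a x} → A a → + a ≡ x mod P → rep x ≡ a
  rep-unique {a} {x} a∈A a≡x =
    proj₂ (proj₂ A-reps) (rep x) a (rep∈A x) a∈A (mod⇒%-≡ p (mod-trans (rep≡ x) (mod-sym a≡x)))

  rep-resp : ∀ {x y} → x ≡ y mod P → rep x ≡ rep y
  rep-resp {x} x≡y = sym (rep-unique (rep∈A x) (mod-trans (rep≡ x) x≡y))

  carry-entry : ℕ → ℕ → ℕ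
  carry-entry a b = reduce p² (a ℕ.+ b ℕ.+ (p² ℕ.∸ rep (+ (a ℕ.+ b))))

  carry-entry-isCarry : ∀ a b → IsCarry p A a b (carry-entry a b)
  carry-entry-isCarry a b =
    rep (+ (a ℕ.+ b)) , rep∈A (+ (a ℕ.+ b)) , mod⇒%-≡ {rep (+ (a ℕ.+ b))} {a ℕ.+ b} p (rep≡ (+ (a ℕ.+ b))) , refl

  isCarry⇒≡carry-entry : ∀ a b {e} → IsCarry p A a b e → e ≡ carry-entry a b
  isCarry⇒≡carry-entry a b (a′ , a′∈A , a′≡a+b , refl) =
    cong (λ r → reduce p² (a ℕ.+ b ℕ.+ (p² ℕ.∸ r))) (sym (rep-unique a′∈A (%-≡⇒mod {b = a ℕ.+ b} p a′≡a+b)))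

  carry-entry<p² : ∀ a b → carry-entry a b ℕ.< p²
  carry-entry<p² a b = m%n<n (a ℕ.+ b ℕ.+ (p² ℕ.∸ rep (+ (a ℕ.+ b)))) p²

  carry-entry≡ : ∀ a b → + carry-entry a b ≡ + a + + b - + rep (+ (a ℕ.+ b)) mod N
  carry-entry≡ a b = begin
    + carry-entry a b                     ≈⟨ mod-sym (%ℕ-mod (+ (a ℕ.+ b ℕ.+ (p² ℕ.∸ r))) p²) ⟩
    + (a ℕ.+ b ℕ.+ (p² ℕ.∸ r))            ≡⟨ expand ⟩
    (+ a + + b - + r) + 1ℤ * N            ≈⟨ +-multiple-mod (+ a + + b - + r) 1ℤ ⟩
    + a + + b - + r                       ∎
    where
    open ≡-mod-Reasoning N
    r = rep (+ (a ℕ.+ b))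
    expand : + (a ℕ.+ b ℕ.+ (p² ℕ.∸ r)) ≡ (+ a + + b - + r) + 1ℤ * N
    expand = trans (pos-+ (a ℕ.+ b) (p² ℕ.∸ r))
               (trans (cong₂ _+_ (pos-+ a b) (pos-∸ (ℕ.<⇒≤ (A<p² (rep∈A (+ (a ℕ.+ b)))))))
                 (regroup (+ a) (+ b) (+ r) N))
      where regroup : ∀ a b r N → a + b + (N - r) ≡ (a + b - r) + 1ℤ * N
            regroup = solve-∀

  z : ℕ
  z = rep 0ℤ

  section : ℤ → ℤ
  section x = + rep x - + z

  section≡id : ∀ x → section x ≡ x mod P
  section≡id x = mod-trans (+-cong-mod (rep≡ x) (-‿cong-mod (rep≡ 0ℤ))) (mod-reflexive (+-identityʳ x))

  section-resp : ∀ {x y} → x ≡ y mod P → section x ≡ section y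
  section-resp x≡y = cong (λ r → + r - + z) (rep-resp x≡y)

  section-0 : section 0ℤ ≡ 0ℤ
  section-0 = +-inverseʳ (+ z)

  carry-section : ∀ x y → carry section x y ≡ + carry-entry (rep x) (rep y) - + z mod N
  carry-section x y = begin
    (+ rep x - + z) + (+ rep y - + z) - (+ rep (x + y) - + z)
      ≡⟨ cong (λ r → (+ rep x - + z) + (+ rep y - + z) - (+ r - + z)) (rep-resp rx+ry≡x+y) ⟨
    (+ rep x - + z) + (+ rep y - + z) - (+ rep (+ (rep x ℕ.+ rep y)) - + z)
      ≡⟨ regroup (+ rep x) (+ rep y) (+ rep (+ (rep x ℕ.+ rep y))) (+ z) ⟩
    (+ rep x + + rep y - + rep (+ (rep x ℕ.+ rep y))) - + z
      ≈⟨ +-congʳ-mod (- + z) (mod-sym (carry-entry≡ (rep x) (rep y))) ⟩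
    + carry-entry (rep x) (rep y) - + z ∎
    where
    open ≡-mod-Reasoning N
    rx+ry≡x+y : + (rep x ℕ.+ rep y) ≡ x + y mod P
    rx+ry≡x+y = mod-trans (mod-reflexive (pos-+ (rep x) (rep y))) (+-cong-mod (rep≡ x) (rep≡ y))
    regroup : ∀ a b c z → (a - z) + (b - z) - (c - z) ≡ (a + b - c) - z
    regroup = solve-∀

  carry-entry-z-z : carry-entry z z ≡ z
  carry-entry-z-z = mod-canonical (carry-entry<p² z z) (A<p² (rep∈A 0ℤ)) (begin
    + carry-entry z z                    ≈⟨ carry-entry≡ z z ⟩
    + z + + z - + rep (+ (z ℕ.+ z))      ≡⟨ cong (λ r → + z + + z - + r) (rep-resp 2z≡0) ⟩
    + z + + z - + z                      ≡⟨ cancel (+ z) ⟩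
    + z                                  ∎)
    where
    open ≡-mod-Reasoning N
    2z≡0 : + (z ℕ.+ z) ≡ 0ℤ mod P
    2z≡0 = mod-trans (mod-reflexive (pos-+ z z)) (+-cong-mod (rep≡ 0ℤ) (rep≡ 0ℤ))
    cancel : ∀ z → z + z - z ≡ z
    cancel = solve-∀

  P∣N : P ∣ N
  P∣N = divides P (pos-* p p)

  carry-entry≡0 : ∀ a b → + carry-entry a b ≡ 0ℤ mod P
  carry-entry≡0 a b = begin
    + carry-entry a b                   ≈⟨ mod-weaken P∣N (carry-entry≡ a b) ⟩
    + a + + b - + rep (+ (a ℕ.+ b))     ≈⟨ +-congˡ-mod (+ a + + b) (-‿cong-mod (rep≡ (+ (a ℕ.+ b)))) ⟩
    + a + + b - + (a ℕ.+ b)             ≡⟨ cong (λ t → + a + + b - t) (pos-+ a b) ⟩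
    + a + + b - (+ a + + b)             ≡⟨ +-inverseʳ (+ a + + b) ⟩
    0ℤ                                  ∎
    where open ≡-mod-Reasoning P

  Realised : ℕ → Set
  Realised e = ∃[ a ] ∃[ b ] (A a × A b × IsCarry p A a b e)

  NormalisedCarries : Set
  NormalisedCarries = ∃[ u ] (¬ (u ≡ 0ℤ mod P) ×
    (∀ x y → (carry section x y ≡ 0ℤ mod P * P) ⊎ (carry section x y ≡ u * P mod P * P)))

  carries-normalised : ∀ {e₀ e} → z ≡ e₀ → e₀ ≢ e → Realised e →
    (∀ a b → A a → A b → carry-entry a b ≡ e₀ ⊎ carry-entry a b ≡ e) → NormalisedCarries
  carries-normalised {e₀} {e} z≡e₀ e₀≢e (a , b , _ , _ , e-isCarry) entries = u , u≢0 , carry∈0,uP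
    where
    e≡entry : e ≡ carry-entry a b
    e≡entry = isCarry⇒≡carry-entry a b e-isCarry
    P∣e-z : P ∣ + e - + z - 0ℤ
    P∣e-z = divides-difference (-cong-mod (subst (λ t → + t ≡ 0ℤ mod P) (sym e≡entry) (carry-entry≡0 a b))
                                          (rep≡ 0ℤ))
    u : ℤ
    u = quotient P∣e-z
    e-z≡uP : + e - + z ≡ u * P
    e-z≡uP = trans (sym (+-identityʳ (+ e - + z))) (_∣_.equality P∣e-z)
    u≢0 : ¬ (u ≡ 0ℤ mod P)
    u≢0 (congruent P∣u-0) = e₀≢e (trans (sym z≡e₀) (sym e≡z))
      where
      e≡z+N : + e ≡ + z mod N
      e≡z+N = mod-P*P⇒mod-N (congruent (subst (P * P ∣_) (sym e-z≡uP)
                (*-monoˡ-∣ P (subst (P ∣_) (+-identityʳ u) P∣u-0))))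
      e≡z : e ≡ z
      e≡z = mod-canonical (subst (ℕ._< p²) (sym e≡entry) (carry-entry<p² a b)) (A<p² (rep∈A 0ℤ)) e≡z+N
    carry∈0,uP : ∀ x y → (carry section x y ≡ 0ℤ mod P * P) ⊎ (carry section x y ≡ u * P mod P * P)
    carry∈0,uP x y = Sum.map
      (λ entry≡e₀ → mod-N⇒mod-P*P (mod-trans (carry-section x y)
        (mod-reflexive (trans (cong (λ t → + t - + z) (trans entry≡e₀ (sym z≡e₀))) (+-inverseʳ (+ z))))))
      (λ entry≡e → mod-N⇒mod-P*P (mod-trans (carry-section x y)
        (mod-reflexive (trans (cong (λ t → + t - + z) entry≡e) e-z≡uP))))
      (entries (rep x) (rep y) (rep∈A x) (rep∈A y))

  carries-two-valued⇒normalised : CarriesTwoValued p A → NormalisedCarries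
  carries-two-valued⇒normalised (e₁ , e₂ , e₁≢e₂ , entries , realised₁ , realised₂) =
    Sum.[ (λ z≡e₁ → carries-normalised z≡e₁ e₁≢e₂ realised₂ entries′)
        , (λ z≡e₂ → carries-normalised z≡e₂ (e₁≢e₂ ∘ sym) realised₁ (λ a b a∈A b∈A → Sum.swap (entries′ a b a∈A b∈A)))
        ]′ z≡e₁⊎z≡e₂
    where
    entries′ : ∀ a b → A a → A b → carry-entry a b ≡ e₁ ⊎ carry-entry a b ≡ e₂
    entries′ a b a∈A b∈A = entries a b (carry-entry a b) a∈A b∈A (carry-entry-isCarry a b)
    z≡e₁⊎z≡e₂ : z ≡ e₁ ⊎ z ≡ e₂
    z≡e₁⊎z≡e₂ = subst (λ t → t ≡ e₁ ⊎ t ≡ e₂) carry-entry-z-z (entries′ z z (rep∈A 0ℤ) (rep∈A 0ℤ))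

-- The affine normal form

module AffineNormalForm (q : ℕ) (p-prime : Prime (suc q)) (A : ℕ → Set)
                        (A-reps : IsCosetReps (suc q) A) (two-valued : CarriesTwoValued (suc q) A) where

  open CosetRepresentatives q A A-reps

  normalised : NormalisedCarries
  normalised = carries-two-valued⇒normalised two-valued

  open CarryNormalForm q p-prime section section≡id section-resp section-0
         (proj₁ normalised) (proj₁ (proj₂ normalised)) (proj₂ (proj₂ normalised))
    using (C; Y; C*Y≡1; normal-form)

  c d : ℕ
  c = C %ℕ p²
  d = (- (C * + z)) %ℕ p²

  C≡c : C ≡ + c mod N
  C≡c = %ℕ-mod C p²

  -Cz≡d : - (C * + z) ≡ + d mod N
  -Cz≡d = %ℕ-mod (- (C * + z)) p²

  c<p² : c ℕ.< p²
  c<p² = n%ℕd<d C p²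

  d<p² : d ℕ.< p²
  d<p² = n%ℕd<d (- (C * + z)) p²

  c-coprime : Coprime c p²
  c-coprime = mod-invertible⇒coprime Y (mod-trans (*-congʳ-mod Y (mod-sym C≡c)) (mod-P*P⇒mod-N C*Y≡1))

  p∣d : p ℕ.∣ d
  p∣d = ℕ.m%n≡0⇒n∣m d p (mod⇒%-≡ {d} {0} p (begin
    + d               ≈⟨ mod-weaken P∣N (mod-sym -Cz≡d) ⟩
    - (C * + z)       ≈⟨ -‿cong-mod (*-congˡ-mod C (rep≡ 0ℤ)) ⟩
    - (C * 0ℤ)        ≡⟨ cong -_ (*-zeroʳ C) ⟩
    0ℤ                ∎))
    where open ≡-mod-Reasoning P

  affine-image : ∀ {a} → A a → reduce p² (c ℕ.* a ℕ.+ d) ≡ (C * + a) %ℕ p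
  affine-image {a} a∈A = %ℕ-canonical p² (ℕ.<-≤-trans (n%ℕd<d (C * + a) p) (ℕ.m≤m*n p p)) (begin
    + (c ℕ.* a ℕ.+ d)       ≡⟨ trans (pos-+ (c ℕ.* a) d) (cong (_+ + d) (pos-* c a)) ⟩
    + c * + a + + d         ≈⟨ +-cong-mod (*-congʳ-mod (+ a) C≡c) -Cz≡d ⟨
    C * + a + - (C * + z)   ≡⟨ factor C (+ a) (+ z) ⟩
    C * (+ a - + z)         ≡⟨ cong (λ r → C * (+ r - + z)) (rep-unique a∈A (mod-reflexive refl)) ⟨
    C * section (+ a)       ≈⟨ mod-P*P⇒mod-N (normal-form (+ a)) ⟩
    + ((C * + a) %ℕ p)      ∎)
    where
    open ≡-mod-Reasoning N
    factor : ∀ C a z → C * a + - (C * z) ≡ C * (a - z)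
    factor = solve-∀

  C*a≡x : ∀ x → C * + rep (Y * + x) ≡ + x mod P
  C*a≡x x = begin
    C * + rep (Y * + x)     ≈⟨ *-congˡ-mod C (rep≡ (Y * + x)) ⟩
    C * (Y * + x)           ≡⟨ reassoc C Y (+ x) ⟩
    C * + x * Y             ≈⟨ *-inverse-cancel-mod {c = C} (+ x) (mod-weaken (∣m⇒∣m*n {P} P ∣-refl) C*Y≡1) ⟩
    + x                     ∎
    where
    open ≡-mod-Reasoning P
    reassoc : ∀ C Y x → C * (Y * x) ≡ C * x * Y
    reassoc = solve-∀

  image⇔digits : ∀ x → InAffineImage p A c d x ⇔ x ℕ.< p
  image⇔digits x = mk⇔ to-digit from-digit
    where
    to-digit : InAffineImage p A c d x → x ℕ.< p
    to-digit (a , a∈A , x≡) = subst (ℕ._< p) (sym (trans x≡ (affine-image a∈A))) (n%ℕd<d (C * + a) p)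
    from-digit : x ℕ.< p → InAffineImage p A c d x
    from-digit x<p = rep (Y * + x) , rep∈A (Y * + x) ,
                     sym (trans (affine-image (rep∈A (Y * + x))) (%ℕ-canonical p x<p (C*a≡x x)))

theorem6p1 : (p : ℕ) → Prime p → (A : ℕ → Set) → IsCosetReps p A →
    CarriesTwoValued p A →
    ∃[ c ] ∃[ d ] ((c ℕ.< p ℕ.* p × Coprime c (p ℕ.* p)) × (d ℕ.< p ℕ.* p × p ℕ.∣ d) ×
      ((∀ x → InAffineImage p A c d x ⇔ x ℕ.< p) ⊎
       (∀ x → InAffineImage p A c d x ⇔ (1 ℕ.≤ x × x ℕ.≤ p))))
theorem6p1 zero    p-prime = contradiction (nonTrivial⇒n>1 0 {{prime⇒nonTrivial p-prime}}) λ ()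
theorem6p1 (suc q) p-prime A A-reps two-valued = c , d , (c<p² , c-coprime) , (d<p² , p∣d) , inj₁ image⇔digits
  where open AffineNormalForm q p-prime A A-reps two-valued
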